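{- Every graphic quotient of $M(F)$ is isomorphic to $M(Q_i)$ for some $i\in\{1,2,3,4\}$, where: $Q_1=F$; $Q_2$ is the graph with two vertices joined by four parallel edges and one loop at one of the vertices; $Q_3$ is the graph with two vertices joined by three parallel edges and two loops at the same vertex; $Q_4$ is the graph with two vertices joined by three parallel edges and one loop at each vertex.
   Context: $F$ is the graph on three vertices $u,v,w$ with two parallel edges between $u$ and $v$, two parallel edges between $u$ and $w$, and one edge between $v$ and $w$; $M(F)$ is its cycle matroid. A quotient of $M(F)$ is a matroid of the form $Q/a$, where $Q$ is a binary matroid and $a\in E(Q)$ with $Q\backslash a=M(F)$; it is graphic if it is the cycle matroid of a graph. -}

module Defs where

open import Data.Nat using (ℕ; zero; suc)
open import Data.Bool using (Bool; true; false; _∧_; _xor_)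
open import Data.Fin using (Fin; zero; suc; inject₁; fromℕ)
open import Data.Fin.Subset using (Subset; _∈_; _⊆_; ⊥; ⁅_⁆)
open import Data.Fin.Permutation using (Permutation′; _⟨$⟩ˡ_)
open import Data.Vec using (Vec; []; _∷_; foldr; zipWith; tabulate; lookup)
open import Data.Product using (_×_; _,_; Σ; ∃)
open import Data.Sum using (_⊎_)
open import Relation.Nullary using (¬_)
open import Relation.Binary.PropositionalEquality using (_≡_)
open import Function.Definitions using (Injective)
open import Function.Bundles using (_⇔_)

-- Matroids on the ground set Fin n, given by their independent sets.
-- (All matroids below arise from GF(2)-matrices or graphs, so the
-- matroid axioms hold automatically; we only need the independence
-- predicate.)

IndepPred : ℕ → Set₁
IndepPred n = Subset n → Set

SameMatroid : ∀ {n} → IndepPred n → IndepPred n → Set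
SameMatroid I J = ∀ X → I X ⇔ J X

image : ∀ {n} → Permutation′ n → Subset n → Subset n
image σ X = tabulate (λ j → lookup X (σ ⟨$⟩ˡ j))

Isomorphic : ∀ {n} → IndepPred n → IndepPred n → Set
Isomorphic {n} I J = Σ (Permutation′ n) λ σ → ∀ X → I X ⇔ J (image σ X)

-- Binary matroids: the vector matroid of a matrix over GF(2) = Bool
-- (addition = xor, multiplication = ∧).  A : Fin r → Vec Bool n gives the
-- rows; columns are indexed by Fin n.

colSum : ∀ {r n} → (Fin r → Vec Bool n) → Subset n → Fin r → Bool
colSum A Y i = foldr _ _xor_ false (zipWith _∧_ Y (A i))

-- X is independent iff the only GF(2)-linear combination of the columns
-- in X equal to zero is the trivial one (coefficients over GF(2) are
-- exactly subsets Y ⊆ X).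
BinIndep : ∀ {r n} → (Fin r → Vec Bool n) → IndepPred n
BinIndep A X = ∀ Y → Y ⊆ X → (∀ i → colSum A Y i ≡ false) → Y ≡ ⊥

-- Single-element deletion and contraction of the element  zero  from a
-- matroid on Fin (suc n); the remaining elements are  suc e, e : Fin n,
-- and a subset of Fin (suc n) is  b ∷ X  with b the membership of zero.

deleteZero : ∀ {n} → IndepPred (suc n) → IndepPred n
deleteZero I X = I (false ∷ X)

contractZero : ∀ {n} → IndepPred (suc n) → IndepPred n
contractZero I X = (¬ I ⁅ zero ⁆ × I (false ∷ X)) ⊎ (I ⁅ zero ⁆ × I (true ∷ X))

record Graph (m : ℕ) : Set where
  field
    nv   : ℕ
    ends : Fin m → Fin nv × Fin nv
open Graph public

Joins : ∀ {m} (G : Graph m) → Fin m → Fin (nv G) → Fin (nv G) → Set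
Joins G e x y = (ends G e ≡ (x , y)) ⊎ (ends G e ≡ (y , x))

-- A cycle of G with all edges in X: a closed trail
-- v₀ e₀ v₁ e₁ … v_k e_k v_{k+1} = v₀ with (k+1) distinct edges and
-- distinct vertices v₀,…,v_k.  (k = 0 gives a loop.)
record CycleIn {m} (G : Graph m) (X : Subset m) : Set where
  field
    k      : ℕ
    es     : Fin (suc k) → Fin m
    vs     : Fin (suc (suc k)) → Fin (nv G)
    closed : vs (fromℕ (suc k)) ≡ vs zero
    es-inj : Injective _≡_ _≡_ es
    vs-inj : Injective _≡_ _≡_ (λ i → vs (inject₁ i))
    es∈X   : ∀ i → es i ∈ X
    joins  : ∀ i → Joins G (es i) (vs (inject₁ i)) (vs (suc i))

CycleIndep : ∀ {m} → Graph m → IndepPred m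
CycleIndep G X = ¬ CycleIn G X

Graphic : ∀ {m} → IndepPred m → Set
Graphic {m} I = Σ (Graph m) λ G → SameMatroid I (CycleIndep G)

mkGraph : ∀ {m} nv → Vec (Fin nv × Fin nv) m → Graph m
mkGraph n es = record { nv = n ; ends = lookup es }

v₀ : ∀ {n} → Fin (suc n)
v₀ = zero
v₁ : ∀ {n} → Fin (suc (suc n))
v₁ = suc zero
v₂ : ∀ {n} → Fin (suc (suc (suc n)))
v₂ = suc (suc zero)

F : Graph 5
F = mkGraph 3 ((v₀ , v₁) ∷ (v₀ , v₁) ∷ (v₀ , v₂) ∷ (v₀ , v₂) ∷ (v₁ , v₂) ∷ [])

Q₁ : Graph 5
Q₁ = F

Q₂ : Graph 5
Q₂ = mkGraph 2 ((v₀ , v₁) ∷ (v₀ , v₁) ∷ (v₀ , v₁) ∷ (v₀ , v₁) ∷ (v₀ , v₀) ∷ [])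

Q₃ : Graph 5
Q₃ = mkGraph 2 ((v₀ , v₁) ∷ (v₀ , v₁) ∷ (v₀ , v₁) ∷ (v₀ , v₀) ∷ (v₀ , v₀) ∷ [])

Q₄ : Graph 5
Q₄ = mkGraph 2 ((v₀ , v₁) ∷ (v₀ , v₁) ∷ (v₀ , v₁) ∷ (v₀ , v₀) ∷ (v₁ , v₁) ∷ [])

-- Quotients of M(F): Q/a where Q is binary with ground set
-- E(F) ⊔ {a} (a = zero, e ∈ E(F) ↦ suc e) and Q\a = M(F).

IsBinaryExtensionOfMF : ∀ {r} → (Fin r → Vec Bool 6) → Set
IsBinaryExtensionOfMF A = SameMatroid (deleteZero (BinIndep A)) (CycleIndep F)

-- Let a be the element 0 of Q and e₀, …, e₄ the edges of F.  Since {e₀,e₁},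
-- {e₂,e₃} and {e₀,e₂,e₄} are circuits of Q\a = M(F), the columns satisfy
-- e₁ = e₀, e₃ = e₂ and e₄ = e₀ + e₂.  Hence the columns in a set Y sum to zero
-- exactly when κ Y, the corresponding combination of the columns a, e₀, e₂,
-- lies in the space of linear relations among these three columns.  As
-- {e₀, e₂} is independent, that space is 0 or the line spanned by a vector
-- (1, s).  So a is a coloop or a loop (and Q/a = Q\a = M(F)), parallel to e₀
-- or e₂ (and Q/a ≅ M(Q₃)), or parallel to e₄ (and Q/a ≅ M(Q₂)); each of these
-- five matroids is compared with its graph by a finite computation.

module Submission where

open import Defs
open import Data.Nat using (ℕ; zero; suc; _<_)
open import Data.Nat.Properties using (anyUpTo?)
open import Data.Bool using (Bool; true; false; _∧_; _xor_)
open import Data.Bool.Properties using (∧-distribʳ-xor; xor-∧-commutativeRing)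
  renaming (_≟_ to _≟ᵇ_)
open import Data.Empty using () renaming (⊥ to Empty)
open import Data.Fin using (Fin; zero; suc; inject₁; fromℕ)
open import Data.Fin.Patterns using (0F; 1F; 2F; 3F; 4F)
open import Data.Fin.Properties using (all?; any?; injective⇒≤) renaming (_≟_ to _≟ᶠ_)
open import Data.Fin.Subset using (Subset; _∈_; _⊆_; ⁅_⁆; inside; outside) renaming (⊥ to ∅)
open import Data.Fin.Subset.Properties using (_⊆?_; _∈?_; ⊆-refl; drop-∷-⊆; anySubset?)
open import Data.Fin.Permutation using (Permutation′; id; transpose; _∘ₚ_)
open import Data.Maybe using (Maybe; nothing; just)
open import Data.Vec using (Vec; []; _∷_; lookup; tabulate; zipWith; foldr)
open import Data.Vec.Properties using (lookup∘tabulate; tabulate∘lookup; ∷-injectiveʳ)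
  renaming (≡-dec to ≡-dec-Vec)
open import Data.Vec.Base using (here)
open import Data.Product using (_×_; _,_; ∃; ∃-syntax; proj₁; proj₂)
open import Data.Product.Properties using () renaming (≡-dec to ≡-dec-×)
open import Data.Sum using (_⊎_; inj₁; inj₂) renaming (map to map-⊎)
open import Function using (_∘_)
open import Function.Bundles using (_⇔_; mk⇔; Equivalence)
open import Function.Definitions using (Injective)
open import Function.Construct.Composition using (_⇔-∘_)
open import Function.Construct.Symmetry using (⇔-sym)
open import Relation.Nullary using (Dec; yes; no; ¬_; contradiction)
open import Relation.Unary using (Decidable)
open import Relation.Nullary.Decidable
  using (map; map′; _×-dec_; _⊎-dec_; _→-dec_; ¬?; True; toWitness)
open import Relation.Binary.PropositionalEquality
  using (_≡_; _≢_; refl; sym; trans; cong; cong₂; subst; _≗_; module ≡-Reasoning)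
open import Algebra using (CommutativeRing)
open import Algebra.Properties.CommutativeSemigroup
  (CommutativeRing.+-commutativeSemigroup xor-∧-commutativeRing) using (interchange)

allSubset? : ∀ {n} {P : Subset n → Set} → Decidable P → Dec (∀ X → P X)
allSubset? {zero} P? = map′ (λ p → λ { [] → p }) (λ h → h []) (P? [])
allSubset? {suc n} P? =
  map′ (λ (p , q) → λ { (true ∷ X) → p X ; (false ∷ X) → q X })
       (λ h → (λ X → h (true ∷ X)) , (λ X → h (false ∷ X)))
       (allSubset? (λ X → P? (true ∷ X)) ×-dec allSubset? (λ X → P? (false ∷ X)))

anyVec? : ∀ {m l} {P : Vec (Fin m) l → Set} → Decidable P → Dec (∃ P)
anyVec? {l = zero} P? = map′ ([] ,_) (λ { ([] , p) → p }) (P? [])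
anyVec? {l = suc l} P? =
  map′ (λ (x , v , p) → x ∷ v , p) (λ { (x ∷ v , p) → x , v , p })
       (any? λ x → anyVec? λ v → P? (x ∷ v))

-- The entrywise condition Q is tested as soon as an entry is chosen, which
-- prunes the search.
anyVecWith? : ∀ {m l} {Q : Fin l → Fin m → Set} {R : Vec (Fin m) l → Set} →
              (∀ i x → Dec (Q i x)) → Decidable R →
              Dec (∃ λ v → (∀ i → Q i (lookup v i)) × R v)
anyVecWith? {l = zero} Q? R? = map′ (λ r → [] , (λ ()) , r) (λ { ([] , _ , r) → r }) (R? [])
anyVecWith? {l = suc l} Q? R? =
  map′ (λ (x , q , v , qs , r) → x ∷ v , (λ { zero → q ; (suc i) → qs i }) , r)
       (λ { (x ∷ v , qs , r) → x , qs zero , v , qs ∘ suc , r })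
       (any? λ x → Q? zero x ×-dec anyVecWith? (Q? ∘ suc) (R? ∘ (x ∷_)))

injective? : ∀ {a b} (f : Fin a → Fin b) → Dec (Injective _≡_ _≡_ f)
injective? f = map′ (λ h {i} {j} → h i j) (λ h i j → h)
  (all? λ i → all? λ j → (f i ≟ᶠ f j) →-dec (i ≟ᶠ j))

_⇔-dec_ : ∀ {A B : Set} → Dec A → Dec B → Dec (A ⇔ B)
a? ⇔-dec b? = map′ (λ (f , g) → mk⇔ f g) (λ e → Equivalence.to e , Equivalence.from e)
  ((a? →-dec b?) ×-dec (b? →-dec a?))

module _ {m} (G : Graph m) (X : Subset m) where

  ClosedSimple : ∀ {k} → (Fin (suc (suc k)) → Fin (nv G)) → Set
  ClosedSimple {k} vs = vs (fromℕ (suc k)) ≡ vs zero × Injective _≡_ _≡_ (vs ∘ inject₁)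

  Step : ∀ {k} → (Fin (suc (suc k)) → Fin (nv G)) → Fin (suc k) → Fin m → Set
  Step vs i e = Joins G e (vs (inject₁ i)) (vs (suc i)) × e ∈ X

  TrailAlong : ∀ {k} → (Fin (suc (suc k)) → Fin (nv G)) → (Fin (suc k) → Fin m) → Set
  TrailAlong vs es = (∀ i → Step vs i (es i)) × Injective _≡_ _≡_ es

  ClosedSimple-resp : ∀ {k} {vs vs′ : Fin (suc (suc k)) → Fin (nv G)} → vs ≗ vs′ →
                      ClosedSimple vs → ClosedSimple vs′
  ClosedSimple-resp v (closed , vs-inj) =
    trans (sym (v _)) (trans closed (v zero)) , λ p → vs-inj (trans (v _) (trans p (sym (v _))))

  TrailAlong-resp : ∀ {k} {vs vs′ : Fin (suc (suc k)) → Fin (nv G)} {es es′} →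
                    vs ≗ vs′ → es ≗ es′ → TrailAlong vs es → TrailAlong vs′ es′
  TrailAlong-resp v e (steps , es-inj) =
      (λ i → let joins , e∈X = steps i in
             Joins-resp (e i) (v (inject₁ i)) (v (suc i)) joins , subst (_∈ X) (e i) e∈X)
    , λ p → es-inj (trans (e _) (trans p (sym (e _))))
    where
    Joins-resp : ∀ {e e′ x x′ y y′} → e ≡ e′ → x ≡ x′ → y ≡ y′ → Joins G e x y → Joins G e′ x′ y′
    Joins-resp refl refl refl j = j

  CycleIn⇔ : CycleIn G X ⇔
    (∃[ k ] k < nv G × ∃[ vs ] ClosedSimple (lookup vs)
                    × ∃[ es ] TrailAlong {k} (lookup vs) (lookup es))
  CycleIn⇔ = mk⇔
    (λ C → let open CycleIn C in
       k , injective⇒≤ vs-inj ,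
       tabulate vs , ClosedSimple-resp (sym ∘ lookup∘tabulate vs) (closed , vs-inj) ,
       tabulate es , TrailAlong-resp (sym ∘ lookup∘tabulate vs) (sym ∘ lookup∘tabulate es)
                       ((λ i → joins i , es∈X i) , es-inj))
    (λ (k , _ , vs , (closed , vs-inj) , es , steps , es-inj) → record
       { k = k ; es = lookup es ; vs = lookup vs ; closed = closed ; es-inj = es-inj
       ; vs-inj = vs-inj ; es∈X = proj₂ ∘ steps ; joins = proj₁ ∘ steps })

  joins? : ∀ e x y → Dec (Joins G e x y)
  joins? e x y = ends G e ≟ₚ (x , y) ⊎-dec ends G e ≟ₚ (y , x)
    where _≟ₚ_ = ≡-dec-× _≟ᶠ_ _≟ᶠ_

  CycleIn? : Dec (CycleIn G X)
  CycleIn? = map (⇔-sym CycleIn⇔) (anyUpTo? (λ k → anyVec? λ vs →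
    closedSimple? (lookup vs)
    ×-dec anyVecWith? (step? {k} (lookup vs)) (injective? ∘ lookup)) (nv G))
    where
    closedSimple? : ∀ {k} (vs : Fin (suc (suc k)) → Fin (nv G)) → Dec (ClosedSimple vs)
    closedSimple? {k} vs = (vs (fromℕ (suc k)) ≟ᶠ vs zero) ×-dec injective? (vs ∘ inject₁)

    step? : ∀ {k} vs i e → Dec (Step {k} vs i e)
    step? vs i e = joins? e (vs (inject₁ i)) (vs (suc i)) ×-dec e ∈? X

CycleIndep? : ∀ {m} (G : Graph m) → Decidable (CycleIndep G)
CycleIndep? G X = ¬? (CycleIn? G X)

-- For D the sets of columns with zero sum this is exactly BinIndep.
IndepOf : ∀ {n} → (Subset n → Set) → IndepPred n
IndepOf D X = ∀ Y → Y ⊆ X → D Y → Y ≡ ∅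

IndepOf-cong : ∀ {n} {D D′ : Subset n → Set} → (∀ Y → D Y ⇔ D′ Y) →
               SameMatroid (IndepOf D) (IndepOf D′)
IndepOf-cong D⇔D′ X = mk⇔ (λ i Y Y⊆X d → i Y Y⊆X (Equivalence.from (D⇔D′ Y) d))
                          (λ i Y Y⊆X d → i Y Y⊆X (Equivalence.to (D⇔D′ Y) d))

IndepOf? : ∀ {n} {D : Subset n → Set} → Decidable D → Decidable (IndepOf D)
IndepOf? D? X = allSubset? λ Y → (Y ⊆? X) →-dec (D? Y →-dec ≡-dec-Vec _≟ᵇ_ Y ∅)

contractZero-cong : ∀ {n} {I J : IndepPred (suc n)} → SameMatroid I J →
                    SameMatroid (contractZero I) (contractZero J)
contractZero-cong I⇔J X = mk⇔
  (map-⊎ (λ (¬a , i) → ¬a ∘ from (I⇔J _) , to (I⇔J _) i)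
         (λ (a , i) → to (I⇔J _) a , to (I⇔J _) i))
  (map-⊎ (λ (¬a , i) → ¬a ∘ to (I⇔J _) , from (I⇔J _) i)
         (λ (a , i) → from (I⇔J _) a , from (I⇔J _) i))
  where open Equivalence

contractZero? : ∀ {n} {I : IndepPred (suc n)} → Decidable I → Decidable (contractZero I)
contractZero? I? X = (¬? (I? ⁅ zero ⁆) ×-dec I? (outside ∷ X))
               ⊎-dec (I? ⁅ zero ⁆ ×-dec I? (inside ∷ X))

Isomorphic-respˡ : ∀ {n} {I J K : IndepPred n} → SameMatroid I J → Isomorphic J K → Isomorphic I K
Isomorphic-respˡ I⇔J (σ , J≅K) = σ , λ X → J≅K X ⇔-∘ I⇔J X

sameMatroid? : ∀ {n} {I J : IndepPred n} → Decidable I → Decidable J → Dec (SameMatroid I J)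
sameMatroid? I? J? = allSubset? λ X → I? X ⇔-dec J? X

SameMatroid⇒Isomorphic : ∀ {n} {I J : IndepPred n} → SameMatroid I J → Isomorphic I J
SameMatroid⇒Isomorphic {J = J} I⇔J =
  id , λ X → subst (λ Y → _ ⇔ J Y) (sym (tabulate∘lookup X)) (I⇔J X)

Circuit : ∀ {n} → IndepPred n → Subset n → Set
Circuit I C = ¬ I C × (∀ Y → Y ⊆ C → Y ≢ C → I Y)

Circuit? : ∀ {n} {I : IndepPred n} → Decidable I → Decidable (Circuit I)
Circuit? I? C = ¬? (I? C) ×-dec
  allSubset? λ Y → (Y ⊆? C) →-dec (¬? (≡-dec-Vec _≟ᵇ_ Y C) →-dec I? Y)

Circuit-resp : ∀ {n} {I J : IndepPred n} {C} → SameMatroid I J → Circuit J C → Circuit I C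
Circuit-resp I⇔J (dep , minimal) =
  dep ∘ Equivalence.to (I⇔J _) , λ Y Y⊆C Y≢C → Equivalence.from (I⇔J Y) (minimal Y Y⊆C Y≢C)

Circuit-deleteZero : ∀ {n} {I : IndepPred (suc n)} {C} →
                     Circuit (deleteZero I) C → Circuit I (outside ∷ C)
Circuit-deleteZero (dep , minimal) = dep , λ
  { (true ∷ Y) Y⊆C Y≢C → contradiction (Y⊆C here) λ ()
  ; (false ∷ Y) Y⊆C Y≢C → minimal Y (drop-∷-⊆ Y⊆C) (Y≢C ∘ cong (false ∷_)) }

dot : ∀ {n} → Subset n → Vec Bool n → Bool
dot Y x = foldr _ _xor_ false (zipWith _∧_ Y x)

_⊕_ : ∀ {n} → Subset n → Subset n → Subset n
_⊕_ = zipWith _xor_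

dot-∅ : ∀ {n} (x : Vec Bool n) → dot ∅ x ≡ false
dot-∅ [] = refl
dot-∅ (_ ∷ x) = dot-∅ x

dot-⊕ : ∀ {n} (Y Y′ : Subset n) x → dot (Y ⊕ Y′) x ≡ dot Y x xor dot Y′ x
dot-⊕ [] [] [] = refl
dot-⊕ (y ∷ Y) (y′ ∷ Y′) (x ∷ xs) = begin
  ((y xor y′) ∧ x) xor dot (Y ⊕ Y′) xs
    ≡⟨ cong₂ _xor_ (∧-distribʳ-xor x y y′) (dot-⊕ Y Y′ xs) ⟩
  ((y ∧ x) xor (y′ ∧ x)) xor (dot Y xs xor dot Y′ xs)
    ≡⟨ interchange (y ∧ x) (y′ ∧ x) (dot Y xs) (dot Y′ xs) ⟩
  ((y ∧ x) xor dot Y xs) xor ((y′ ∧ x) xor dot Y′ xs) ∎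
  where open ≡-Reasoning

⊕≡∅⇒≡ : ∀ {n} (s t : Subset n) → s ⊕ t ≡ ∅ → s ≡ t
⊕≡∅⇒≡ [] [] _ = refl
⊕≡∅⇒≡ (false ∷ s) (false ∷ t) e = cong (false ∷_) (⊕≡∅⇒≡ s t (∷-injectiveʳ e))
⊕≡∅⇒≡ (true ∷ s) (true ∷ t) e = cong (true ∷_) (⊕≡∅⇒≡ s t (∷-injectiveʳ e))
⊕≡∅⇒≡ (false ∷ s) (true ∷ t) ()
⊕≡∅⇒≡ (true ∷ s) (false ∷ t) ()

ZeroSum : ∀ {r n} → (Fin r → Vec Bool n) → Subset n → Set
ZeroSum A Y = ∀ i → colSum A Y i ≡ false

module _ {r n} (A : Fin r → Vec Bool n) where

  ZeroSum? : Decidable (ZeroSum A)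
  ZeroSum? Y = all? λ i → colSum A Y i ≟ᵇ false

  ZeroSum-∅ : ZeroSum A ∅
  ZeroSum-∅ i = dot-∅ (A i)

  ZeroSum-⊕ : ∀ {Y Y′} → ZeroSum A Y → ZeroSum A Y′ → ZeroSum A (Y ⊕ Y′)
  ZeroSum-⊕ {Y} {Y′} z z′ i = trans (dot-⊕ Y Y′ (A i)) (cong₂ _xor_ (z i) (z′ i))

  Circuit⇒ZeroSum : ∀ {C} → Circuit (BinIndep A) C → ZeroSum A C
  Circuit⇒ZeroSum {C} (dep , minimal) with ZeroSum? C
  ... | yes z = z
  ... | no ¬z = contradiction onlyTrivial dep
    where
    onlyTrivial : BinIndep A C
    onlyTrivial Y Y⊆C zY with ≡-dec-Vec _≟ᵇ_ Y C
    ... | yes refl = contradiction zY ¬z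
    ... | no Y≢C = minimal Y Y⊆C Y≢C Y ⊆-refl zY

Line : ∀ {n} → Maybe (Subset n) → Subset (suc n) → Set
Line m (false ∷ u) = u ≡ ∅
Line nothing (true ∷ u) = Empty
Line (just s) (true ∷ u) = u ≡ s

Line? : ∀ {n} (m : Maybe (Subset n)) → Decidable (Line m)
Line? m (false ∷ u) = ≡-dec-Vec _≟ᵇ_ u ∅
Line? nothing (true ∷ u) = no λ ()
Line? (just s) (true ∷ u) = ≡-dec-Vec _≟ᵇ_ u s

-- Two vectors of W with leading coordinate 1 differ by a vector of W with
-- leading coordinate 0, hence coincide.
subspace⇒Line : ∀ {n} {W : Subset (suc n) → Set} → Decidable W → W ∅ →
                (∀ {c c′} → W c → W c′ → W (c ⊕ c′)) → (∀ {u} → W (false ∷ u) → u ≡ ∅) →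
                ∃[ m ] ∀ c → W c ⇔ Line m c
subspace⇒Line W? W∅ closed meet with anySubset? (λ s → W? (true ∷ s))
... | yes (s , Ws) = just s , λ where
  (false ∷ u) → mk⇔ meet λ { refl → W∅ }
  (true ∷ u) → mk⇔ (λ Wu → ⊕≡∅⇒≡ u s (meet (closed Wu Ws))) λ { refl → Ws }
... | no ¬Wtrue = nothing , λ where
  (false ∷ u) → mk⇔ meet λ { refl → W∅ }
  (true ∷ u) → mk⇔ (λ Wu → ¬Wtrue (u , Wu)) λ ()

-- The ground set of Q is a = 0 and eᵢ = 1 + i; κ Y is written in the basis a, e₀, e₂.
κ : Subset 6 → Subset 3
κ (y ∷ y₀ ∷ y₁ ∷ y₂ ∷ y₃ ∷ y₄ ∷ []) = y ∷ (y₁ xor y₄ xor y₀) ∷ (y₃ xor y₄ xor y₂) ∷ []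

reduce : Vec Bool 6 → Vec Bool 3
reduce x = lookup x 0F ∷ lookup x 1F ∷ lookup x 3F ∷ []

e₀e₁ e₂e₃ e₀e₂e₄ : Subset 5
e₀e₁ = inside ∷ inside ∷ outside ∷ outside ∷ outside ∷ []
e₂e₃ = outside ∷ outside ∷ inside ∷ inside ∷ outside ∷ []
e₀e₂e₄ = inside ∷ outside ∷ inside ∷ outside ∷ inside ∷ []

dot-reduce : ∀ x → dot (outside ∷ e₀e₁) x ≡ false → dot (outside ∷ e₂e₃) x ≡ false →
             dot (outside ∷ e₀e₂e₄) x ≡ false → ∀ Y → dot Y x ≡ dot (κ Y) (reduce x)
dot-reduce = toWitness {a? = allSubset? λ x →
  (dot (outside ∷ e₀e₁) x ≟ᵇ false) →-dec (dot (outside ∷ e₂e₃) x ≟ᵇ false) →-dec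
  (dot (outside ∷ e₀e₂e₄) x ≟ᵇ false) →-dec allSubset? λ Y → dot Y x ≟ᵇ dot (κ Y) (reduce x)} _

circuitOfF : ∀ C → {True (Circuit? (CycleIndep? F) C)} → Circuit (CycleIndep F) C
circuitOfF C {t} = toWitness t

subsetOfe₀e₂ : Subset 2 → Subset 5
subsetOfe₀e₂ (u₀ ∷ u₁ ∷ []) = u₀ ∷ outside ∷ u₁ ∷ outside ∷ outside ∷ []

subsetOfe₀e₂-∅ : ∀ u → outside ∷ subsetOfe₀e₂ u ≡ ∅ → u ≡ ∅
subsetOfe₀e₂-∅ (_ ∷ _ ∷ []) refl = refl

subsetOfe₀e₂-independent : ∀ u → CycleIndep F (subsetOfe₀e₂ u)
subsetOfe₀e₂-independent = toWitness {a? = allSubset? (CycleIndep? F ∘ subsetOfe₀e₂)} _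

LineMatroid : Maybe (Subset 2) → IndepPred 6
LineMatroid m = IndepOf (Line m ∘ κ)

LineMatroid? : ∀ m → Decidable (LineMatroid m)
LineMatroid? m = IndepOf? (Line? m ∘ κ)

module BinaryExtension {r} (A : Fin r → Vec Bool 6) (H : IsBinaryExtensionOfMF A) where

  B : Fin r → Vec Bool 3
  B = reduce ∘ A

  zeroSum-circuitOfF : ∀ C → {True (Circuit? (CycleIndep? F) C)} → ZeroSum A (outside ∷ C)
  zeroSum-circuitOfF C {t} =
    Circuit⇒ZeroSum A (Circuit-deleteZero (Circuit-resp H (circuitOfF C {t})))

  ZeroSum⇔κ : ∀ Y → ZeroSum A Y ⇔ ZeroSum B (κ Y)
  ZeroSum⇔κ Y = mk⇔ (λ z i → trans (sym (column-sum i)) (z i)) (λ z i → trans (column-sum i) (z i))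
    where
    column-sum : ∀ i → colSum A Y i ≡ colSum B (κ Y) i
    column-sum i = dot-reduce (A i) (zeroSum-circuitOfF e₀e₁ i) (zeroSum-circuitOfF e₂e₃ i)
                                    (zeroSum-circuitOfF e₀e₂e₄ i) Y

  e₀e₂-noRelation : ∀ {u} → ZeroSum B (false ∷ u) → u ≡ ∅
  e₀e₂-noRelation {u@(_ ∷ _ ∷ [])} z =
    subsetOfe₀e₂-∅ u (Equivalence.from (H _) (subsetOfe₀e₂-independent u) _ ⊆-refl
                        (Equivalence.from (ZeroSum⇔κ (outside ∷ subsetOfe₀e₂ u)) z))

  relationsOnLine : ∃[ m ] SameMatroid (BinIndep A) (LineMatroid m)
  relationsOnLine
    with m , W⇔Line ← subspace⇒Line (ZeroSum? B) (ZeroSum-∅ B)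
                        (λ {c} {c′} → ZeroSum-⊕ B {c} {c′}) e₀e₂-noRelation =
    m , IndepOf-cong λ Y → W⇔Line (κ Y) ⇔-∘ ZeroSum⇔κ Y

contractZero≈deleteZero : ∀ m →
  {True (sameMatroid? (contractZero? (LineMatroid? m)) (LineMatroid? m ∘ (outside ∷_)))} →
  SameMatroid (contractZero (LineMatroid m)) (deleteZero (LineMatroid m))
contractZero≈deleteZero m {t} = toWitness t

lineQuotient≅ : ∀ m (Q : Graph 5) (σ : Permutation′ 5) →
  {True (sameMatroid? (contractZero? (LineMatroid? m)) (CycleIndep? Q ∘ image σ))} →
  Isomorphic (contractZero (LineMatroid m)) (CycleIndep Q)
lineQuotient≅ m Q σ {t} = σ , toWitness t

QuotientCases : IndepPred 6 → Set
QuotientCases I = SameMatroid (contractZero I) (deleteZero I)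
                       ⊎ Isomorphic (contractZero I) (CycleIndep Q₂)
                       ⊎ Isomorphic (contractZero I) (CycleIndep Q₃)

-- The line spanned by (1, s) means a = s₀ e₀ + s₁ e₂: for s = 00 the element
-- a is a loop and for m = nothing a coloop, so that Q/a = Q\a.
lineQuotient : ∀ m → QuotientCases (LineMatroid m)
lineQuotient nothing = inj₁ (contractZero≈deleteZero nothing)
lineQuotient m@(just (false ∷ false ∷ [])) = inj₁ (contractZero≈deleteZero m)
lineQuotient m@(just (true ∷ false ∷ [])) =
  inj₂ (inj₂ (lineQuotient≅ m Q₃ (transpose 0F 3F ∘ₚ transpose 1F 4F)))
lineQuotient m@(just (false ∷ true ∷ [])) = inj₂ (inj₂ (lineQuotient≅ m Q₃ (transpose 2F 4F)))
lineQuotient m@(just (true ∷ true ∷ [])) = inj₂ (inj₁ (lineQuotient≅ m Q₂ id))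

OneOfQ : IndepPred 5 → Set
OneOfQ I = Isomorphic I (CycleIndep Q₁) ⊎ Isomorphic I (CycleIndep Q₂)
         ⊎ Isomorphic I (CycleIndep Q₃) ⊎ Isomorphic I (CycleIndep Q₄)

quotient-classification : ∀ {r} {A : Fin r → Vec Bool 6} {I} → IsBinaryExtensionOfMF A →
  SameMatroid (BinIndep A) I → QuotientCases I → OneOfQ (contractZero (BinIndep A))
quotient-classification H Q≈I (inj₁ contract≈delete) = inj₁ (SameMatroid⇒Isomorphic λ X →
  H X ⇔-∘ (⇔-sym (Q≈I (outside ∷ X)) ⇔-∘ (contract≈delete X ⇔-∘ contractZero-cong Q≈I X)))
quotient-classification H Q≈I (inj₂ (inj₁ ≅Q₂)) =
  inj₂ (inj₁ (Isomorphic-respˡ {K = CycleIndep Q₂} (contractZero-cong Q≈I) ≅Q₂))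
quotient-classification H Q≈I (inj₂ (inj₂ ≅Q₃)) =
  inj₂ (inj₂ (inj₁ (Isomorphic-respˡ {K = CycleIndep Q₃} (contractZero-cong Q≈I) ≅Q₃)))

mainTheorem5 : (r : ℕ) (A : Fin r → Vec Bool 6) →
    IsBinaryExtensionOfMF A →
    Graphic (contractZero (BinIndep A)) →
    Isomorphic (contractZero (BinIndep A)) (CycleIndep Q₁)
      ⊎ Isomorphic (contractZero (BinIndep A)) (CycleIndep Q₂)
      ⊎ Isomorphic (contractZero (BinIndep A)) (CycleIndep Q₃)
      ⊎ Isomorphic (contractZero (BinIndep A)) (CycleIndep Q₄)
mainTheorem5 r A H _ = quotient-classification H Q≈Line (lineQuotient m)
  where open BinaryExtension A H using (relationsOnLine)
        m = proj₁ relationsOnLine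
        Q≈Line = proj₂ relationsOnLine
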